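{- Let $n\ge 2$ and let $B_n$ be the group of signed permutations of $[\pm n]=\{ -n,\dots,-1,1,\dots,n\}$, i.e. bijections $w$ of $[\pm n]$ with $w(-a)=-w(a)$, written in window notation $[w(1)\,w(2)\cdots w(n)]$, with negatives written $\underline{a}=-a$. Define $f^B_0=[\underline{1}\;2\;3\cdots n]$ and, for $1\le i\le n-1$, $f^B_i=[\underline{i+1}\;\underline{i}\;\cdots\;\underline{1}\;(i+2)\cdots n]$, i.e. $f^B_i(m)=-(i+2-m)$ for $1\le m\le i+1$ and $f^B_i(m)=m$ for $i+1<m\le n$. For $0\le a,b\le n-1$ let $m^B_{a,b}$ denote the order of $f^B_af^B_b$. Let $i,j$ be integers with $1\le i<j\le n$. Then: \begin{enumerate} \item $m^B_{i-1,i-1}=1$; \item $m^B_{i-1,j-1}=m^B_{j-1,i-1}$; \item if $j\ge 4$ and $1<i\le\lfloor j/2\rfloor$, then $m^B_{i-1,j-1}=4$; \item if $j\ge4$ and $1\le\lfloor j/2\rfloor<i<j-1$, then, with $d=j-i$, $q=\lfloor j/d\rfloor$ and $r=j\bmod d$, \[m^B_{i-1,j-1}=\begin{cases}2q, & \text{if } r=0,\\ 2q(q+1), & \text{if } r\neq0;\end{cases}\] \item if $j\ge 3$ and $i=j-1$, then $m^B_{i-1,j-1}=2j$. \end{enumerate}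
   Context: Signed permutations are composed as functions. -}

module Defs where

open import Data.Nat as ℕ using (ℕ; zero; suc; _≤_; _<_; _∸_; _≤ᵇ_; NonZero; >-nonZero)
open import Data.Nat.Properties using (m<n⇒0<n∸m)
open import Data.Bool using (if_then_else_; _∧_)
open import Data.Integer using (ℤ; +_; -[1+_]; -_; ∣_∣)
open import Data.Product using (_×_)
open import Relation.Binary.PropositionalEquality using (_≡_)
open import Relation.Nullary using (¬_)
open import Function using (_∘_; id)

-- Signed permutations of [±n] are represented as their action on ℤ
-- (only the values on [±n] = {a : 1 ≤ ∣a∣ ≤ n} matter); the product
-- v · w is function composition v ∘ w (apply w first).

fBwin : ℕ → ℕ → ℤ
fBwin i m = if (1 ≤ᵇ m) ∧ (m ≤ᵇ suc i) then - (+ (suc (suc i) ∸ m)) else + m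

-- f^B_i as a map on ℤ, extended by f(-a) = -f(a).
-- (f^B_0 = [-1 2 3 ... n] is the case i = 0 of the same formula.)
fB : ℕ → ℤ → ℤ
fB i (+ m)     = fBwin i m
fB i -[1+ m ]  = - fBwin i (suc m)

pow : (ℤ → ℤ) → ℕ → (ℤ → ℤ)
pow w zero    = id
pow w (suc k) = w ∘ pow w k

_≈[_]_ : (ℤ → ℤ) → ℕ → (ℤ → ℤ) → Set
w ≈[ n ] v = ∀ (a : ℤ) → 1 ≤ ∣ a ∣ → ∣ a ∣ ≤ n → w a ≡ v a

IsOrder : ℕ → (ℤ → ℤ) → ℕ → Set
IsOrder n w k = (1 ≤ k) × (pow w k ≈[ n ] id)
              × (∀ m → 1 ≤ m → m < k → ¬ (pow w m ≈[ n ] id))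

mB≡ : ℕ → ℕ → ℕ → ℕ → Set
mB≡ n a b k = IsOrder n (fB a ∘ fB b) k

nz : ∀ {i j} → i < j → NonZero (j ∸ i)
nz i<j = >-nonZero (m<n⇒0<n∸m i<j)

quo : (i j : ℕ) → i < j → ℕ
quo i j i<j = ℕ._/_ j (j ∸ i) {{nz i<j}}

rem : (i j : ℕ) → i < j → ℕ
rem i j i<j = ℕ._%_ j (j ∸ i) {{nz i<j}}

-- Let j = a + d + 1 and w = f_a ∘ f_{a+d}. On positive entries w fixes every u > j,
-- shifts u ↦ u − d for d < u ≤ j, and sends s ≤ d to −(j + 1 − s). Hence the cycle of w
-- through s ∈ [1, d] descends in steps of d to −s′, where s′ ∈ [1, d] and
-- s + s′ + c·d = j + 1, and then returns to s by the mirror image: it has length 2(c + 1).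
-- Writing j = q·d + r, every cycle has length 2q when r = 0; otherwise the cycles through
-- s ≤ r have length 2(q + 1) and the others 2q, so the order is 2q(q + 1). Parts 3 and 5
-- are the cases d ≥ i (q = 2, r = 0, or q = 1, r = i) and d = 1, and part 2 holds because
-- f_b f_a is conjugate to f_a f_b by the involution f_a.
module Submission where

open import Defs
open import Data.Bool using (true; false; T)
open import Data.Bool.Properties using (T-≡)
open import Data.Integer using (ℤ; +_; -[1+_]; -_; ∣_∣)
open import Data.Integer.Properties using (neg-involutive; ∣-i∣≡∣i∣)
open import Data.Nat using (ℕ; zero; suc; _≤_; _<_; _∸_; _*_; _+_; _/_; _%_; z≤n; s≤s; _≤ᵇ_; NonZero; >-nonZero; >-nonZero⁻¹)
open import Data.Nat.Properties
open import Data.Nat.Coprimality using (coprime-divisor; coprime-+; 1-coprimeTo)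
open import Data.Nat.DivMod using (m≡m%n+[m/n]*n; m%n<n; m/n*n≤m)
open import Data.Nat.Divisibility using (_∣_; divides; ∣⇒≤; m%n≡0⇒n∣m; m∣m*n; *-cancelˡ-∣; *-monoʳ-∣)
open import Data.Nat.Tactic.RingSolver using (solve-∀)
open import Data.Product using (_×_; _,_; ∃-syntax; proj₁; proj₂)
open import Data.Sum using (inj₁; inj₂)
open import Data.Unit using (tt)
open import Function using (_∘_; id)
open import Function.Bundles using (Equivalence)
open import Function.Definitions using (Injective)
open import Relation.Binary.PropositionalEquality
open import Relation.Nullary using (yes; no; contradiction)

≤ᵇ-true : ∀ {m n} → m ≤ n → (m ≤ᵇ n) ≡ true
≤ᵇ-true = Equivalence.to T-≡ ∘ ≤⇒≤ᵇ

≤ᵇ-false : ∀ {m n} → n < m → (m ≤ᵇ n) ≡ false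
≤ᵇ-false {m} {n} n<m with m ≤ᵇ n in eq
... | false = refl
... | true  = contradiction (≤ᵇ⇒≤ m n (subst T (sym eq) tt)) (<⇒≱ n<m)

-+≢+ : ∀ {m k} → 1 ≤ m → - + m ≢ + k
-+≢+ {suc m} _ ()

fB-odd : ∀ b x → fB b (- x) ≡ - fB b x
fB-odd b (+ zero)  = refl
fB-odd b (+ suc m) = refl
fB-odd b -[1+ m ]  = sym (neg-involutive _)

fB-window : ∀ {b m m′} → 1 ≤ m → 1 ≤ m′ → m + m′ ≡ suc (suc b) → fB b (+ m) ≡ - + m′
fB-window {b} {suc m} {m′} _ 1≤m′ sum
  rewrite ≤ᵇ-true (≤-pred (subst (suc m <_) sum (m<m+n (suc m) 1≤m′)))
  = cong (-_ ∘ +_) (trans (cong (_∸ suc m) (sym sum)) (m+n∸m≡n (suc m) m′))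

fB-window⁻ : ∀ {b m m′} → 1 ≤ m → 1 ≤ m′ → m + m′ ≡ suc (suc b) → fB b (- + m′) ≡ + m
fB-window⁻ {b} {m} {m′} 1≤m 1≤m′ sum =
  trans (fB-odd b (+ m′))
        (trans (cong -_ (fB-window 1≤m′ 1≤m (trans (+-comm m′ m) sum))) (neg-involutive (+ m)))

fB-outside : ∀ {b m} → suc b < m → fB b (+ m) ≡ + m
fB-outside {m = suc m} b+1<m rewrite ≤ᵇ-false b+1<m = refl

fB-involutive : ∀ b x → fB b (fB b x) ≡ x
fB-involutive b (+ m) = positive m
  where
  positive : ∀ m → fB b (fB b (+ m)) ≡ + m
  positive zero = refl
  positive (suc m) with suc m ≤? suc b
  ... | no m≰b = trans (cong (fB b) (fB-outside (≰⇒> m≰b))) (fB-outside (≰⇒> m≰b))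
  ... | yes m≤b with m≤n⇒∃[o]m+o≡n m≤b
  ...   | k , eq = trans (cong (fB b) (fB-window (s≤s z≤n) (s≤s z≤n) sum))
                         (fB-window⁻ (s≤s z≤n) (s≤s z≤n) sum)
    where
    sum : suc m + suc k ≡ suc (suc b)
    sum = trans (+-suc (suc m) k) (cong suc eq)
fB-involutive b -[1+ m ] = trans (fB-odd b (fB b (+ suc m))) (cong -_ (fB-involutive b (+ suc m)))

fB-injective : ∀ b → Injective _≡_ _≡_ (fB b)
fB-injective b {x} {y} eq = trans (sym (fB-involutive b x)) (trans (cong (fB b) eq) (fB-involutive b y))

Preserves± : ℕ → (ℤ → ℤ) → Set
Preserves± n g = ∀ x → 1 ≤ ∣ x ∣ → ∣ x ∣ ≤ n → 1 ≤ ∣ g x ∣ × ∣ g x ∣ ≤ n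

fB-preserves±-positive : ∀ {b n} → b < n → ∀ m → 1 ≤ m → m ≤ n →
                         1 ≤ ∣ fB b (+ m) ∣ × ∣ fB b (+ m) ∣ ≤ n
fB-preserves±-positive {b} {n} b<n (suc m) _ 1+m≤n with suc m ≤? suc b
... | no m≰b rewrite fB-outside (≰⇒> m≰b) = s≤s z≤n , 1+m≤n
... | yes m≤b with m≤n⇒∃[o]m+o≡n m≤b
...   | k , eq rewrite fB-window (s≤s z≤n) (s≤s z≤n) (trans (+-suc (suc m) k) (cong suc eq)) =
        s≤s z≤n , ≤-trans (s≤s (m≤n+m k m)) (subst (_≤ n) (sym eq) b<n)

fB-preserves± : ∀ {b n} → b < n → Preserves± n (fB b)
fB-preserves± b<n (+ m) = fB-preserves±-positive b<n m
fB-preserves± {b} b<n -[1+ m ] rewrite ∣-i∣≡∣i∣ (fB b (+ suc m)) = fB-preserves±-positive b<n (suc m)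

pow-+ : ∀ (w : ℤ → ℤ) m k x → pow w (m + k) x ≡ pow w m (pow w k x)
pow-+ w zero    k x = refl
pow-+ w (suc m) k x = cong w (pow-+ w m k x)

pow-sucʳ : ∀ (w : ℤ → ℤ) c x → pow w (suc c) x ≡ pow w c (w x)
pow-sucʳ w c x = trans (cong (λ k → pow w k x) (+-comm 1 c)) (pow-+ w c 1 x)

pow-comm : ∀ (w : ℤ → ℤ) m k x → pow w m (pow w k x) ≡ pow w k (pow w m x)
pow-comm w m k x = trans (sym (pow-+ w m k x)) (trans (cong (λ e → pow w e x) (+-comm m k)) (pow-+ w k m x))

pow-odd : ∀ (w : ℤ → ℤ) → (∀ x → w (- x) ≡ - w x) → ∀ c x → pow w c (- x) ≡ - pow w c x
pow-odd w w-odd zero    x = refl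
pow-odd w w-odd (suc c) x = trans (cong w (pow-odd w w-odd c x)) (w-odd _)

pow-injective : ∀ (w : ℤ → ℤ) → Injective _≡_ _≡_ w → ∀ c → Injective _≡_ _≡_ (pow w c)
pow-injective w w-inj zero    eq = eq
pow-injective w w-inj (suc c) eq = pow-injective w w-inj c (w-inj eq)

pow-fixed : ∀ (w : ℤ → ℤ) {x} → w x ≡ x → ∀ c → pow w c x ≡ x
pow-fixed w wx≡x zero    = refl
pow-fixed w wx≡x (suc c) = trans (cong w (pow-fixed w wx≡x c)) wx≡x

pow-fixed-backward : ∀ (w : ℤ → ℤ) → Injective _≡_ _≡_ w → ∀ {K x} c →
                     pow w K (pow w c x) ≡ pow w c x → pow w K x ≡ x
pow-fixed-backward w w-inj {K} {x} c fixed =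
  pow-injective w w-inj c (trans (pow-comm w c K x) fixed)

pow-multiple : ∀ (w : ℤ → ℤ) {x P m} → pow w P x ≡ x → P ∣ m → pow w m x ≡ x
pow-multiple w {x} {P} fixed (divides t refl) = go t
  where
  go : ∀ t → pow w (t * P) x ≡ x
  go zero    = refl
  go (suc t) = trans (pow-+ w P (t * P) x) (trans (cong (pow w P) (go t)) fixed)

IsPeriod : (ℤ → ℤ) → ℤ → ℕ → Set
IsPeriod w x P = 1 ≤ P × pow w P x ≡ x × (∀ t → 1 ≤ t → t < P → pow w t x ≢ x)

period-divides : ∀ (w : ℤ → ℤ) {x P m} → IsPeriod w x P → pow w m x ≡ x → P ∣ m
period-divides w {x} {suc P} {m} (_ , fixed , minimal) fixedₘ with m % suc P in eq
... | zero  = m%n≡0⇒n∣m m (suc P) eq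
... | suc r = contradiction fixedᵣ (minimal (suc r) (s≤s z≤n) (subst (_< suc P) eq (m%n<n m (suc P))))
  where
  open ≡-Reasoning
  fixedᵣ : pow w (suc r) x ≡ x
  fixedᵣ = begin
    pow w (suc r) x                               ≡⟨ cong (pow w (suc r)) (pow-multiple w fixed (divides (m / suc P) refl)) ⟨
    pow w (suc r) (pow w (m / suc P * suc P) x)   ≡⟨ pow-+ w (suc r) _ x ⟨
    pow w (suc r + m / suc P * suc P) x           ≡⟨ cong (λ e → pow w (e + m / suc P * suc P) x) eq ⟨
    pow w (m % suc P + m / suc P * suc P) x       ≡⟨ cong (λ e → pow w e x) (m≡m%n+[m/n]*n m (suc P)) ⟨
    pow w m x                                     ≡⟨ fixedₘ ⟩
    x                                             ∎

period-of-half : ∀ (w : ℤ → ℤ) {x h} → 1 ≤ h → pow w (h + h) x ≡ x →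
                 (∀ t → 1 ≤ t → t ≤ h → pow w t x ≢ x) → IsPeriod w x (h + h)
period-of-half w {x} {h} 1≤h fixed early = ≤-trans 1≤h (m≤m+n h h) , fixed , minimal
  where
  minimal : ∀ t → 1 ≤ t → t < h + h → pow w t x ≢ x
  minimal t 1≤t t<2h with t ≤? h
  ... | yes t≤h = early t 1≤t t≤h
  ... | no t≰h with m≤n⇒∃[o]m+o≡n (<⇒≤ t<2h)
  ...   | e , t+e≡2h = λ fixedₜ → early e 1≤e e≤h (begin
            pow w e x            ≡⟨ cong (pow w e) fixedₜ ⟨
            pow w e (pow w t x)  ≡⟨ pow-+ w e t x ⟨
            pow w (e + t) x      ≡⟨ cong (λ k → pow w k x) (trans (+-comm e t) t+e≡2h) ⟩
            pow w (h + h) x      ≡⟨ fixed ⟩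
            x                    ∎)
    where
    open ≡-Reasoning
    e≤h : e ≤ h
    e≤h = +-cancelˡ-≤ h e h (≤-trans (+-monoˡ-≤ e (<⇒≤ (≰⇒> t≰h))) (≤-reflexive t+e≡2h))
    1≤e : 1 ≤ e
    1≤e = n≢0⇒n>0 λ e≡0 →
      <-irrefl (trans (sym (+-identityʳ t)) (subst (λ k → t + k ≡ h + h) e≡0 t+e≡2h)) t<2h

isOrder-by-divisibility : ∀ {n w K} → 1 ≤ K → pow w K ≈[ n ] id →
                          (∀ m → pow w m ≈[ n ] id → K ∣ m) → IsOrder n w K
isOrder-by-divisibility 1≤K fixed divides-all =
  1≤K , fixed , λ m 1≤m m<K fixedₘ → <⇒≱ m<K (∣⇒≤ {{>-nonZero 1≤m}} (divides-all m fixedₘ))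

isOrder-one : ∀ {n w} → (∀ x → w x ≡ x) → IsOrder n w 1
isOrder-one w≗id = s≤s z≤n , (λ x _ _ → w≗id x) , λ m 1≤m m<1 _ → <⇒≱ m<1 1≤m

pow-conjugate : ∀ (f g : ℤ → ℤ) m y → pow (g ∘ f) m (g y) ≡ g (pow (f ∘ g) m y)
pow-conjugate f g zero    y = refl
pow-conjugate f g (suc m) y = cong (g ∘ f) (pow-conjugate f g m y)

pow-swap≈id : ∀ {n} (f g : ℤ → ℤ) → (∀ x → g (g x) ≡ x) → Preserves± n g →
              ∀ m → pow (f ∘ g) m ≈[ n ] id → pow (g ∘ f) m ≈[ n ] id
pow-swap≈id f g g-inv g-pres m fixed x 1≤x x≤n =
  trans (cong (pow (g ∘ f) m) (sym (g-inv x)))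
 (trans (pow-conjugate f g m (g x))
 (trans (cong g (fixed (g x) (proj₁ (g-pres x 1≤x x≤n)) (proj₂ (g-pres x 1≤x x≤n)))) (g-inv x)))

isOrder-swap : ∀ {n k} (f g : ℤ → ℤ) → (∀ x → f (f x) ≡ x) → (∀ x → g (g x) ≡ x) →
               Preserves± n f → Preserves± n g → IsOrder n (f ∘ g) k → IsOrder n (g ∘ f) k
isOrder-swap {k = k} f g f-inv g-inv f-pres g-pres (1≤k , fixed , minimal) =
  1≤k , pow-swap≈id f g g-inv g-pres k fixed ,
  λ m 1≤m m<k fixedₘ → minimal m 1≤m m<k (pow-swap≈id g f f-inv f-pres m fixedₘ)

*-consecutive-∣ : ∀ k q {m} .{{_ : NonZero k}} → k * q ∣ m → k * (q + 1) ∣ m → k * q * (q + 1) ∣ m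
*-consecutive-∣ k q (divides x refl) k[q+1]∣m =
  subst (k * q * (q + 1) ∣_) (*-comm (k * q) x) (*-monoʳ-∣ (k * q) q+1∣x)
  where
  reassoc : ∀ x k q → x * (k * q) ≡ k * (q * x)
  reassoc = solve-∀
  q+1∣x : q + 1 ∣ x
  q+1∣x = coprime-divisor (coprime-+ (1-coprimeTo q))
            (*-cancelˡ-∣ k (subst (k * (q + 1) ∣_) (reassoc x k q) k[q+1]∣m))

module Orbit (a d : ℕ) .{{_ : NonZero d}} where

  w : ℤ → ℤ
  w = fB a ∘ fB (a + d)

  w-odd : ∀ x → w (- x) ≡ - w x
  w-odd x = trans (cong (fB a) (fB-odd (a + d) x)) (fB-odd a (fB (a + d) x))

  w-injective : Injective _≡_ _≡_ w
  w-injective = fB-injective (a + d) ∘ fB-injective a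

  w-fixes : ∀ {u} → suc (a + d) < u → w (+ u) ≡ + u
  w-fixes j<u = trans (cong (fB a) (fB-outside j<u)) (fB-outside (≤-trans (s≤s (s≤s (m≤m+n a d))) j<u))

  w-shift : ∀ {u} → 1 ≤ u → u ≤ suc a → w (+ (u + d)) ≡ + u
  w-shift {u} 1≤u u≤a+1 with m≤n⇒∃[o]m+o≡n u≤a+1
  ... | k , eq = trans (cong (fB a) (fB-window (≤-trans 1≤u (m≤m+n u d)) (s≤s z≤n) sum))
                       (fB-window⁻ 1≤u (s≤s z≤n) (trans (+-suc u k) (cong suc eq)))
    where
    regroup : ∀ u d k → u + d + suc k ≡ suc (u + k + d)
    regroup = solve-∀
    sum : u + d + suc k ≡ suc (suc (a + d))
    sum = trans (regroup u d k) (cong (λ v → suc (v + d)) eq)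

  w-wrap : ∀ {s m} → 1 ≤ s → s ≤ d → s + m ≡ suc (suc (a + d)) → w (+ s) ≡ - + m
  w-wrap {s} {m} 1≤s s≤d sum =
    trans (cong (fB a) (fB-window 1≤s (≤-trans (s≤s z≤n) a+2≤m) sum))
          (trans (fB-odd a (+ m)) (cong -_ (fB-outside a+2≤m)))
    where
    open ≤-Reasoning
    a+2≤m : suc (suc a) ≤ m
    a+2≤m = +-cancelʳ-≤ d (suc (suc a)) m (begin
      suc (suc (a + d)) ≡⟨ sum ⟨
      s + m             ≤⟨ +-monoˡ-≤ m s≤d ⟩
      d + m             ≡⟨ +-comm d m ⟩
      m + d             ∎)

  pow-w-shift : ∀ c {u} → 1 ≤ u → u + c * d ≤ suc (a + d) → pow w c (+ (u + c * d)) ≡ + u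
  pow-w-shift zero    {u} _   _     = cong +_ (+-identityʳ u)
  pow-w-shift (suc c) {u} 1≤u bound = begin
    pow w (suc c) (+ (u + suc c * d)) ≡⟨ cong (pow w (suc c) ∘ +_) (regroup u c d) ⟩
    pow w (suc c) (+ (u + c * d + d)) ≡⟨ pow-sucʳ w c _ ⟩
    pow w c (w (+ (u + c * d + d)))   ≡⟨ cong (pow w c) (w-shift (≤-trans 1≤u (m≤m+n u (c * d))) v≤a+1) ⟩
    pow w c (+ (u + c * d))           ≡⟨ pow-w-shift c 1≤u (≤-trans v≤a+1 (s≤s (m≤m+n a d))) ⟩
    + u                               ∎
    where
    open ≡-Reasoning
    regroup : ∀ u c d → u + suc c * d ≡ u + c * d + d
    regroup = solve-∀
    v≤a+1 : u + c * d ≤ suc a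
    v≤a+1 = +-cancelʳ-≤ d (u + c * d) (suc a) (subst (_≤ suc a + d) (regroup u c d) bound)

  pow-w-wrap : ∀ e f {s s′} → 1 ≤ s → s ≤ d → 1 ≤ s′ → s + (s′ + (e + f) * d) ≡ suc (suc (a + d)) →
               pow w (suc e) (+ s) ≡ - + (s′ + f * d)
  pow-w-wrap e f {s} {s′} 1≤s s≤d 1≤s′ sum = begin
    pow w (suc e) (+ s)                ≡⟨ pow-sucʳ w e (+ s) ⟩
    pow w e (w (+ s))                  ≡⟨ cong (pow w e) (w-wrap 1≤s s≤d sum) ⟩
    pow w e (- + (s′ + (e + f) * d))   ≡⟨ cong (pow w e ∘ -_ ∘ +_) (regroup s′ e f d) ⟩
    pow w e (- + (s′ + f * d + e * d)) ≡⟨ pow-odd w w-odd e _ ⟩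
    - pow w e (+ (s′ + f * d + e * d)) ≡⟨ cong -_ (pow-w-shift e (≤-trans 1≤s′ (m≤m+n s′ (f * d))) bound) ⟩
    - + (s′ + f * d)                   ∎
    where
    open ≡-Reasoning
    regroup : ∀ s′ e f d → s′ + (e + f) * d ≡ s′ + f * d + e * d
    regroup = solve-∀
    bound : s′ + f * d + e * d ≤ suc (a + d)
    bound = subst (_≤ suc (a + d)) (regroup s′ e f d)
              (≤-pred (≤-trans (+-monoˡ-≤ _ 1≤s) (≤-reflexive sum)))

  record Paired (c s s′ : ℕ) : Set where
    constructor paired
    field
      1≤s  : 1 ≤ s
      s≤d  : s ≤ d
      1≤s′ : 1 ≤ s′
      s′≤d : s′ ≤ d
      sum  : s + (s′ + c * d) ≡ suc (suc (a + d))

  paired-sym : ∀ {c s s′} → Paired c s s′ → Paired c s′ s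
  paired-sym {c} {s} {s′} (paired 1≤s s≤d 1≤s′ s′≤d sum) =
    paired 1≤s′ s′≤d 1≤s s≤d (trans (swap s′ s (c * d)) sum)
    where
    swap : ∀ s′ s x → s′ + (s + x) ≡ s + (s′ + x)
    swap = solve-∀

  paired-half : ∀ {c s s′} → Paired c s s′ → pow w (suc c) (+ s) ≡ - + s′
  paired-half {c} {s} {s′} (paired 1≤s s≤d 1≤s′ _ sum) =
    trans (pow-w-wrap c 0 1≤s s≤d 1≤s′ (subst (λ k → s + (s′ + k * d) ≡ _) (sym (+-identityʳ c)) sum))
          (cong (-_ ∘ +_) (+-identityʳ s′))

  paired-period : ∀ {c s s′} → Paired c s s′ → IsPeriod w (+ s) (2 * suc c)
  paired-period {c} {s} {s′} p@(paired 1≤s s≤d 1≤s′ _ sum) =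
    subst (IsPeriod w (+ s)) (cong (λ k → suc c + k) (sym (+-identityʳ (suc c))))
          (period-of-half w (s≤s z≤n) full early)
    where
    open ≡-Reasoning
    full : pow w (suc c + suc c) (+ s) ≡ + s
    full = begin
      pow w (suc c + suc c) (+ s)          ≡⟨ pow-+ w (suc c) (suc c) (+ s) ⟩
      pow w (suc c) (pow w (suc c) (+ s))  ≡⟨ cong (pow w (suc c)) (paired-half p) ⟩
      pow w (suc c) (- + s′)               ≡⟨ pow-odd w w-odd (suc c) (+ s′) ⟩
      - pow w (suc c) (+ s′)               ≡⟨ cong -_ (paired-half (paired-sym p)) ⟩
      - - + s                              ≡⟨ neg-involutive (+ s) ⟩
      + s                                  ∎
    early : ∀ t → 1 ≤ t → t ≤ suc c → pow w t (+ s) ≢ + s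
    early (suc e) _ (s≤s e≤c) with m≤n⇒∃[o]m+o≡n e≤c
    ... | f , e+f≡c = λ fixed → -+≢+ (≤-trans 1≤s′ (m≤m+n s′ (f * d))) (trans (sym negative) fixed)
      where
      negative : pow w (suc e) (+ s) ≡ - + (s′ + f * d)
      negative = pow-w-wrap e f 1≤s s≤d 1≤s′ (subst (λ k → s + (s′ + k * d) ≡ _) (sym e+f≡c) sum)

  -- The partner is s′ = R + 1 − s; the side condition R < s + d says s′ ≤ d.
  partner : ∀ c {R s} → R + c * d ≡ suc (a + d) → 1 ≤ s → s ≤ d → s ≤ R → R < s + d →
            ∃[ s′ ] Paired c s s′
  partner c {R} {s} sum 1≤s s≤d s≤R R<s+d with m≤n⇒∃[o]m+o≡n s≤R
  ... | k , refl = suc k , paired 1≤s s≤d (s≤s z≤n)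
                   (+-cancelˡ-≤ s (suc k) d (subst (_≤ s + d) (sym (+-suc s k)) R<s+d))
                   (trans (regroup s k (c * d)) (cong suc sum))
    where
    regroup : ∀ s k x → s + (suc k + x) ≡ suc (s + k + x)
    regroup = solve-∀

  pow-w-fixes-positive : ∀ K → (∀ s → 1 ≤ s → s ≤ d → pow w K (+ s) ≡ + s) →
                         ∀ u → pow w K (+ suc u) ≡ + suc u
  pow-w-fixes-positive K fixes u with suc u ≤? suc (a + d)
  ... | no u≰j  = pow-fixed w (w-fixes (≰⇒> u≰j)) K
  ... | yes u≤j = pow-fixed-backward w w-injective {K} (u / d)
                    (trans (cong (pow w K) descent) (trans (fixes _ (s≤s z≤n) (m%n<n u d)) (sym descent)))
    where
    division : suc u ≡ suc (u % d) + u / d * d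
    division = cong suc (m≡m%n+[m/n]*n u d)
    descent : pow w (u / d) (+ suc u) ≡ + suc (u % d)
    descent = trans (cong (pow w (u / d) ∘ +_) division)
                    (pow-w-shift (u / d) (s≤s z≤n) (subst (_≤ suc (a + d)) division u≤j))

  pow-w≈id : ∀ {n} K → (∀ s → 1 ≤ s → s ≤ d → pow w K (+ s) ≡ + s) → pow w K ≈[ n ] id
  pow-w≈id K fixes (+ zero) ()
  pow-w≈id K fixes (+ suc u) _ _ = pow-w-fixes-positive K fixes u
  pow-w≈id K fixes -[1+ u ] _ _ =
    trans (pow-odd w w-odd K (+ suc u)) (cong -_ (pow-w-fixes-positive K fixes u))

  order-divisible : ∀ {n} q → suc (a + d) ≤ n → q * d ≡ suc (a + d) → IsOrder n w (2 * q)
  order-divisible (suc c) j≤n qd≡j =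
    isOrder-by-divisibility (s≤s z≤n)
      (pow-w≈id (2 * suc c) λ s 1≤s s≤d → proj₁ (proj₂ (period s 1≤s s≤d)))
      λ m fixed → period-divides w (period 1 ≤-refl 1≤d) (fixed (+ 1) ≤-refl (≤-trans (s≤s z≤n) j≤n))
    where
    1≤d : 1 ≤ d
    1≤d = >-nonZero⁻¹ d
    period : ∀ s → 1 ≤ s → s ≤ d → IsPeriod w (+ s) (2 * suc c)
    period s 1≤s s≤d = paired-period (proj₂ (partner c qd≡j 1≤s s≤d s≤d (m<n+m d 1≤s)))

  order-indivisible : ∀ {n} q r → suc (a + d) ≤ n → r + q * d ≡ suc (a + d) → 1 ≤ r → r < d →
                      IsOrder n w (2 * q * (q + 1))
  order-indivisible zero r _ sum _ r<d = contradiction d≤r (<⇒≱ r<d)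
    where
    open ≤-Reasoning
    d≤r : d ≤ r
    d≤r = begin
      d          ≤⟨ m≤n+m d (suc a) ⟩
      suc a + d  ≡⟨ sum ⟨
      r + 0      ≡⟨ +-identityʳ r ⟩
      r          ∎
  order-indivisible (suc c) r j≤n sum 1≤r r<d =
    isOrder-by-divisibility (s≤s z≤n) (pow-w≈id K fixes) λ m fixed →
      *-consecutive-∣ 2 (suc c)
        (period-divides w (high-period d r<d ≤-refl)
          (fixed (+ d) 1≤d (≤-trans (m≤n+m d a) (≤-trans (n≤1+n _) j≤n))))
        (subst (λ k → 2 * k ∣ m) (+-comm 1 (suc c))
          (period-divides w (low-period 1 ≤-refl 1≤r) (fixed (+ 1) ≤-refl (≤-trans (s≤s z≤n) j≤n))))
    where
    1≤d : 1 ≤ d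
    1≤d = >-nonZero⁻¹ d
    low-period : ∀ s → 1 ≤ s → s ≤ r → IsPeriod w (+ s) (2 * suc (suc c))
    low-period s 1≤s s≤r =
      paired-period (proj₂ (partner (suc c) sum 1≤s (≤-trans s≤r (<⇒≤ r<d)) s≤r
        (<-≤-trans r<d (m≤n+m d s))))
    high-period : ∀ s → r < s → s ≤ d → IsPeriod w (+ s) (2 * suc c)
    high-period s r<s s≤d =
      paired-period (proj₂ (partner c (trans (+-assoc r d (c * d)) sum)
        (≤-trans (s≤s z≤n) r<s) s≤d (≤-trans s≤d (m≤n+m d r)) (+-monoˡ-< d r<s)))
    K : ℕ
    K = 2 * suc c * (suc c + 1)
    fixes : ∀ s → 1 ≤ s → s ≤ d → pow w K (+ s) ≡ + s
    fixes s 1≤s s≤d with s ≤? r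
    ... | yes s≤r = pow-multiple w {P = 2 * suc (suc c)} {m = K}
                      (proj₁ (proj₂ (low-period s 1≤s s≤r))) (divides (suc c) (reassoc c))
      where
      reassoc : ∀ c → 2 * suc c * (suc c + 1) ≡ suc c * (2 * suc (suc c))
      reassoc = solve-∀
    ... | no s≰r  = pow-multiple w {P = 2 * suc c} {m = K}
                      (proj₁ (proj₂ (high-period s (≰⇒> s≰r) s≤d))) (m∣m*n (suc c + 1))

≤/2⇒+≤ : ∀ {m n} → m ≤ n / 2 → m + m ≤ n
≤/2⇒+≤ {m} {n} m≤n/2 = ≤-trans (≤-reflexive (double m)) (≤-trans (*-monoˡ-≤ 2 m≤n/2) (m/n*n≤m n 2))
  where
  double : ∀ m → m + m ≡ m * 2
  double = solve-∀

mB-divisible : ∀ {n a b d} .{{_ : NonZero d}} q → a + d ≡ b → suc b ≤ n → q * d ≡ suc b → mB≡ n a b (2 * q)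
mB-divisible {a = a} {d = d} q refl = Orbit.order-divisible a d q

mB-indivisible : ∀ {n a b d} .{{_ : NonZero d}} q r → a + d ≡ b → suc b ≤ n → r + q * d ≡ suc b →
                 1 ≤ r → r < d → mB≡ n a b (2 * q * (q + 1))
mB-indivisible {a = a} {d = d} q r refl = Orbit.order-indivisible a d q r

mB-four : ∀ {n a b d} .{{_ : NonZero d}} → a + d ≡ b → suc b ≤ n → suc a ≤ d → mB≡ n a b 4
mB-four {a = a} {d = d} a+d≡b j≤n i≤d with m≤n⇒m<n∨m≡n i≤d
... | inj₁ i<d = mB-indivisible 1 (suc a) a+d≡b j≤n
                   (cong suc (trans (cong (λ k → a + k) (+-identityʳ d)) a+d≡b)) (s≤s z≤n) i<d
... | inj₂ i≡d = mB-divisible 2 a+d≡b j≤n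
                   (trans (cong (λ k → d + k) (+-identityʳ d)) (trans (cong (_+ d) (sym i≡d)) (cong suc a+d≡b)))

theorem4p1 : (n : ℕ) → 2 ≤ n → (i j : ℕ) → 1 ≤ i → (i<j : i < j) → j ≤ n →
      mB≡ n (i ∸ 1) (i ∸ 1) 1
    × (∀ k → (mB≡ n (i ∸ 1) (j ∸ 1) k → mB≡ n (j ∸ 1) (i ∸ 1) k)
           × (mB≡ n (j ∸ 1) (i ∸ 1) k → mB≡ n (i ∸ 1) (j ∸ 1) k))
    × (4 ≤ j → 1 < i → i ≤ j / 2 → mB≡ n (i ∸ 1) (j ∸ 1) 4)
    × (4 ≤ j → 1 ≤ j / 2 → j / 2 < i → i < j ∸ 1 →
         (rem i j i<j ≡ 0 → mB≡ n (i ∸ 1) (j ∸ 1) (2 * quo i j i<j))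
       × (rem i j i<j ≢ 0 →
            mB≡ n (i ∸ 1) (j ∸ 1) (2 * quo i j i<j * (quo i j i<j + 1))))
    × (3 ≤ j → i ≡ j ∸ 1 → mB≡ n (i ∸ 1) (j ∸ 1) (2 * j))
theorem4p1 n _ (suc a) (suc b) _ i<j j≤n =
    isOrder-one (fB-involutive a)
  , (λ k → isOrder-swap (fB a) (fB b) (fB-involutive a) (fB-involutive b) a-pres b-pres
         , isOrder-swap (fB b) (fB a) (fB-involutive b) (fB-involutive a) b-pres a-pres)
  , (λ _ _ i≤j/2 → mB-four a+d≡b j≤n (+-cancelˡ-≤ (suc a) (suc a) d
                     (subst (suc a + suc a ≤_) (sym (cong suc a+d≡b)) (≤/2⇒+≤ i≤j/2))))
  , (λ _ _ _ _ → (λ r≡0 → mB-divisible q a+d≡b j≤n (sym (trans division (cong (_+ q * d) r≡0))))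
               , (λ r≢0 → mB-indivisible q r a+d≡b j≤n (sym division) (n≢0⇒n>0 r≢0) (m%n<n (suc b) d)))
  , (λ _ i≡j-1 → mB-divisible (suc b) (trans (+-comm a 1) i≡j-1) j≤n (*-identityʳ (suc b)))
  where
  d : ℕ
  d = b ∸ a
  instance
    d≢0 : NonZero d
    d≢0 = nz i<j
  a+d≡b : a + d ≡ b
  a+d≡b = m+[n∸m]≡n (<⇒≤ (≤-pred i<j))
  a-pres : Preserves± n (fB a)
  a-pres = fB-preserves± (≤-trans (<⇒≤ i<j) j≤n)
  b-pres : Preserves± n (fB b)
  b-pres = fB-preserves± j≤n
  q r : ℕ
  q = suc b / d
  r = suc b % d
  division : suc b ≡ r + q * d
  division = m≡m%n+[m/n]*n (suc b) d
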